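{- Let $k$ be a positive integer and let $G$ be a graph with $\chi(G)>k$. Then, for every orientation $\vec{G}$ of $G$, the $(k\vec{\ell}(\vec{G})+1)$-backward-blowup of $\vec{G}$ is not $k$-dicolourable.
   Context: For a digraph $D$, $\vec\ell(D)$ is the maximum number of arcs of a subdigraph of $D$ that is a disjoint union of directed paths. For a digraph $D$ and positive integer $n$, the $n$-backward-blowup $D^{\gets n}$ has vertex set $\{(v,i): v\in V(D), i\in[n]\}$ and arc set consisting of the forward arcs $(u,i)\to(v,i)$ for every arc $u\to v$ of $D$ and $i\in[n]$, together with the backward arcs $(v,i)\to(u,j)$ for every arc $u\to v$ of $D$ and all $i,j\in[n]$ with $i\ne j$. A digraph is $k$-dicolourable if its vertex set can be partitioned into $k$ sets each inducing a subdigraph with no directed cycle. -}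

module Defs where

open import Data.Nat using (ℕ; _+_; _*_; _≤_; _<_)
import Data.Nat as ℕ
open import Data.Fin using (Fin; zero; suc; inject₁; fromℕ)
open import Data.Fin.Properties using () renaming (_≟_ to _≟ᶠ_)
open import Data.Bool using (Bool; true; false; if_then_else_; _∧_)
open import Data.List using (List; map; allFin)
open import Data.Nat.ListAction using (sum)
open import Data.Product using (Σ; ∃; _×_; _,_)
open import Data.Sum using (_⊎_)
open import Relation.Nullary using (¬_; ⌊_⌋)
open import Relation.Binary.PropositionalEquality using (_≡_)
open import Function.Definitions using (Injective)

Digraph : Set → Set
Digraph V = V → V → Bool

record Graph (n : ℕ) : Set where
  field
    adj   : Fin n → Fin n → Bool
    sym   : ∀ u v → adj u v ≡ true → adj v u ≡ true
    irrefl : ∀ v → adj v v ≡ false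
open Graph public

ProperColouring : ∀ {n} → Graph n → (k : ℕ) → (Fin n → Fin k) → Set
ProperColouring G k c = ∀ u v → adj G u v ≡ true → ¬ (c u ≡ c v)

χ>_ : ∀ {n} → ℕ → Graph n → Set
(χ> k) G = ¬ (Σ (_ → Fin k) λ c → ProperColouring G k c)

IsOrientation : ∀ {n} → Graph n → Digraph (Fin n) → Set
IsOrientation G D =
  (∀ u v → D u v ≡ true → adj G u v ≡ true) ×
  (∀ u v → adj G u v ≡ true → D u v ≡ true ⊎ D v u ≡ true) ×
  (∀ u v → D u v ≡ true → ¬ (D v u ≡ true))

record DirectedCycle {V : Set} (D : Digraph V) : Set where
  field
    len    : ℕ
    vtx    : Fin (ℕ.suc len) → V
    inj    : Injective _≡_ _≡_ vtx
    arcs   : ∀ (i : Fin len) → D (vtx (inject₁ i)) (vtx (suc i)) ≡ true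
    close  : D (vtx (fromℕ len)) (vtx zero) ≡ true

Acyclic : ∀ {V : Set} → Digraph V → Set
Acyclic D = ¬ DirectedCycle D

induced : ∀ {V : Set} → Digraph V → (V → Bool) → Digraph V
induced D P u v = D u v ∧ P u ∧ P v

colourIs : ∀ {V : Set} {k} → (V → Fin k) → Fin k → V → Bool
colourIs c a v = ⌊ c v ≟ᶠ a ⌋

Dicolourable : ∀ {V : Set} → ℕ → Digraph V → Set
Dicolourable {V} k D =
  Σ (V → Fin k) λ c → ∀ (a : Fin k) → Acyclic (induced D (colourIs c a))

backwardBlowup : ∀ {n} → Digraph (Fin n) → (m : ℕ) → Digraph (Fin n × Fin m)
backwardBlowup D m (u , i) (v , j) =
  if ⌊ i ≟ᶠ j ⌋ then D u v else D v u

record PathForest {n} (D : Digraph (Fin n)) (F : Digraph (Fin n)) : Set where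
  field
    sub    : ∀ u v → F u v ≡ true → D u v ≡ true
    outDeg : ∀ u v w → F u v ≡ true → F u w ≡ true → v ≡ w
    inDeg  : ∀ u v w → F v u ≡ true → F w u ≡ true → v ≡ w
    acyc   : Acyclic F

arcCount : ∀ {n} → Digraph (Fin n) → ℕ
arcCount {n} F =
  sum (map (λ u → sum (map (λ v → if F u v then 1 else 0) (allFin n))) (allFin n))

-- ℓ is the value of ℓ⃗(D): the maximum number of arcs of a path-forest subdigraph
IsLongestPathForestSize : ∀ {n} → Digraph (Fin n) → ℕ → Set
IsLongestPathForestSize D ℓ =
  (Σ _ λ F → PathForest D F × arcCount F ≡ ℓ) ×
  (∀ F → PathForest D F → arcCount F ≤ ℓ)

-- In each copy i of the blowup the forward arcs form a copy of D, so the colouring restricted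
-- to it is a k-colouring of G and some arc tᵢ → hᵢ of D is monochromatic, of colour aᵢ. Two
-- copies of the same colour sharing a tail (or a head) would close a monochromatic 4-cycle
-- through two backward arcs; hence the arcs tᵢ → hᵢ of colour a form a subdigraph Fₐ of D of
-- maximum in- and out-degree 1. A directed cycle in Fₐ, read backwards through the copies of
-- its arcs, is a directed cycle of colour a in the blowup, so Fₐ is a union of disjoint paths
-- and has at most ℓ arcs. Thus every colour is used by at most ℓ copies, i.e. kℓ + 1 ≤ kℓ.
module Submission where

open import Defs hiding (sym)
open import Data.Nat using (ℕ; zero; suc; _+_; _*_; _≤_; z≤n)
open import Data.Nat.Properties
  using (≤-refl; ≤-trans; +-mono-≤; +-monoʳ-≤; m≤m+n; m≤n+m; *-zeroʳ; *-identityʳ;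
         m+1+n≰m; +-commutativeSemigroup; module ≤-Reasoning)
open import Data.Nat.ListAction using (sum)
open import Data.Fin using (Fin; zero; suc; inject₁; fromℕ; opposite)
open import Data.Fin.Properties using (any?; opposite-involutive) renaming (_≟_ to _≟ᶠ_)
open import Data.Fin.Patterns using (0F; 1F; 2F; 3F)
open import Data.Bool using (Bool; true; false; if_then_else_)
import Data.Bool.Properties as Bool
open import Data.List using (List; []; _∷_; map; allFin; length)
open import Data.List.Properties using (length-tabulate)
open import Data.List.Relation.Unary.All using (All; []; _∷_)
import Data.List.Relation.Unary.All as All
open import Data.List.Relation.Unary.All.Properties using (tabulate⁺)
open import Data.List.Relation.Unary.AllPairs using (AllPairs; []; _∷_)
import Data.List.Relation.Unary.AllPairs as AllPairs
open import Data.List.Relation.Unary.Any using (here; there)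
open import Data.List.Membership.Propositional using (_∈_)
open import Data.List.Membership.Propositional.Properties using (∈-allFin)
open import Data.List.Relation.Unary.Unique.Propositional.Properties using (allFin⁺)
open import Data.Product using (∃; _×_; _,_; proj₁; proj₂)
open import Data.Sum using (_⊎_; inj₁; inj₂)
open import Function using (_∘_; flip)
open import Function.Bundles using (Equivalence)
open import Function.Definitions using (Injective)
open import Relation.Nullary using (¬_; Dec; yes; no; ⌊_⌋; contradiction)
open import Relation.Nullary.Decidable using (toWitness; fromWitness; _×-dec_)
open import Relation.Binary.PropositionalEquality
  using (_≡_; _≢_; refl; sym; trans; cong; subst)
open import Algebra.Properties.CommutativeSemigroup +-commutativeSemigroup using (interchange)

⌊⌋≡true⇒ : {A : Set} (a? : Dec A) → ⌊ a? ⌋ ≡ true → A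
⌊⌋≡true⇒ a? = toWitness {a? = a?} ∘ Equivalence.from Bool.T-≡

⇒⌊⌋≡true : {A : Set} (a? : Dec A) → A → ⌊ a? ⌋ ≡ true
⇒⌊⌋≡true a? = Equivalence.to Bool.T-≡ ∘ fromWitness {a? = a?}

sumOver : {A : Set} → List A → (A → ℕ) → ℕ
sumOver L f = sum (map f L)

count : {A : Set} → List A → (A → Bool) → ℕ
count L p = sumOver L (λ x → if p x then 1 else 0)

sumOver-const : {A : Set} (L : List A) (c : ℕ) → sumOver L (λ _ → c) ≡ length L * c
sumOver-const []      c = refl
sumOver-const (x ∷ L) c = cong (c +_) (sumOver-const L c)


sumOver-mono-≤ : {A : Set} (L : List A) {f g : A → ℕ} → (∀ x → f x ≤ g x) → sumOver L f ≤ sumOver L g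
sumOver-mono-≤ []      f≤g = z≤n
sumOver-mono-≤ (x ∷ L) f≤g = +-mono-≤ (f≤g x) (sumOver-mono-≤ L f≤g)

sumOver-+ : {A : Set} (L : List A) (f g : A → ℕ) →
            sumOver L (λ x → f x + g x) ≡ sumOver L f + sumOver L g
sumOver-+ []      f g = refl
sumOver-+ (x ∷ L) f g = trans (cong (f x + g x +_) (sumOver-+ L f g))
                              (interchange (f x) (g x) (sumOver L f) (sumOver L g))

∈⇒≤sumOver : {A : Set} {L : List A} {x : A} (f : A → ℕ) → x ∈ L → f x ≤ sumOver L f
∈⇒≤sumOver f (here refl)         = m≤m+n _ _
∈⇒≤sumOver {L = y ∷ L} f (there x∈L) = ≤-trans (∈⇒≤sumOver f x∈L) (m≤n+m _ (f y))

∈⇒1≤count : {A : Set} {L : List A} {x : A} (p : A → Bool) → x ∈ L → p x ≡ true → 1 ≤ count L p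
∈⇒1≤count {L = L} p x∈L px = subst (λ b → (if b then 1 else 0) ≤ count L p) px
                           (∈⇒≤sumOver (λ x → if p x then 1 else 0) x∈L)

sumOver-comm : {A B : Set} (L : List A) (M : List B) (f : A → B → ℕ) →
               sumOver L (λ x → sumOver M (f x)) ≡ sumOver M (λ y → sumOver L (λ x → f x y))
sumOver-comm []      M f = sym (trans (sumOver-const M 0) (*-zeroʳ (length M)))
sumOver-comm (x ∷ L) M f = trans (cong (sumOver M (f x) +_) (sumOver-comm L M f))
                                 (sym (sumOver-+ M (f x) (λ y → sumOver L (λ x → f x y))))

sumOver-allFin-const : (n c : ℕ) → sumOver (allFin n) (λ _ → c) ≡ n * c
sumOver-allFin-const n c = trans (sumOver-const (allFin n) c) (cong (_* c) (length-tabulate {n = n} (λ i → i)))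

sumOver-removePoint : {n : ℕ} (h : Fin n → ℕ) (y : Fin n) → 1 ≤ h y →
  1 + sumOver (allFin n) (λ z → if ⌊ z ≟ᶠ y ⌋ then 0 else h z) ≤ sumOver (allFin n) h
sumOver-removePoint {n} h y 1≤hy = begin
  1 + sumOver (allFin n) h′             ≤⟨ +-mono-≤ (∈⇒1≤count is-y (∈-allFin y) (⇒⌊⌋≡true (y ≟ᶠ y) refl)) ≤-refl ⟩
  count (allFin n) is-y + sumOver (allFin n) h′
    ≡⟨ sym (sumOver-+ (allFin n) (λ z → if is-y z then 1 else 0) h′) ⟩
  sumOver (allFin n) (λ z → (if is-y z then 1 else 0) + h′ z)
                                        ≤⟨ sumOver-mono-≤ (allFin n) pointwise ⟩
  sumOver (allFin n) h                  ∎
  where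
  open ≤-Reasoning
  is-y : Fin n → Bool
  is-y z = ⌊ z ≟ᶠ y ⌋
  h′ : Fin n → ℕ
  h′ z = if is-y z then 0 else h z
  pointwise : ∀ z → (if is-y z then 1 else 0) + h′ z ≤ h z
  pointwise z with z ≟ᶠ y
  ... | yes refl = 1≤hy
  ... | no _     = ≤-refl

-- Each selected x is charged to the cell g x of h; distinct selected elements use distinct cells.
count-≤-sumOver-injection : {A : Set} {n : ℕ} (p : A → Bool) (g : A → Fin n) (h : Fin n → ℕ)
  (L : List A) → AllPairs (λ x y → p x ≡ true → p y ≡ true → g x ≢ g y) L →
  All (λ x → p x ≡ true → 1 ≤ h (g x)) L → count L p ≤ sumOver (allFin n) h
count-≤-sumOver-injection p g h []      _  _ = z≤n
count-≤-sumOver-injection {n = n} p g h (x ∷ L) (x-apart ∷ apart) (x-pos ∷ pos) with p x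
... | false = count-≤-sumOver-injection p g h L apart pos
... | true  = begin
  1 + count L p             ≤⟨ +-monoʳ-≤ 1 (count-≤-sumOver-injection p g h′ L apart pos′) ⟩
  1 + sumOver (allFin n) h′ ≤⟨ sumOver-removePoint h (g x) (x-pos refl) ⟩
  sumOver (allFin n) h      ∎
  where
  open ≤-Reasoning
  h′ : Fin n → ℕ
  h′ z = if ⌊ z ≟ᶠ g x ⌋ then 0 else h z
  stillPositive : ∀ {y} → (p y ≡ true → 1 ≤ h (g y)) → (p y ≡ true → g x ≢ g y) →
                  p y ≡ true → 1 ≤ h′ (g y)
  stillPositive {y} y-pos xy-apart py with g y ≟ᶠ g x
  ... | yes gy≡gx = contradiction (sym gy≡gx) (xy-apart py)
  ... | no _      = y-pos py
  pos′ : All (λ y → p y ≡ true → 1 ≤ h′ (g y)) L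
  pos′ = All.zipWith (λ (y-pos , xy-apart) → stillPositive y-pos (xy-apart refl)) (pos , x-apart)

boundedFibres⇒≤ : {m k : ℕ} (ℓ : ℕ) (f : Fin m → Fin k) →
  (∀ a → count (allFin m) (λ i → ⌊ f i ≟ᶠ a ⌋) ≤ ℓ) → m ≤ k * ℓ
boundedFibres⇒≤ {m} {k} ℓ f fibre≤ℓ = begin
  m                                                   ≡⟨ sym (trans (sumOver-allFin-const m 1) (*-identityʳ m)) ⟩
  sumOver (allFin m) (λ _ → 1)                        ≤⟨ sumOver-mono-≤ (allFin m) hasColour ⟩
  sumOver (allFin m) (λ i → count (allFin k) (fibre i)) ≡⟨ sumOver-comm (allFin m) (allFin k) _ ⟩
  sumOver (allFin k) (λ a → count (allFin m) (λ i → fibre i a))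
                                                      ≤⟨ sumOver-mono-≤ (allFin k) fibre≤ℓ ⟩
  sumOver (allFin k) (λ _ → ℓ)                        ≡⟨ sumOver-allFin-const k ℓ ⟩
  k * ℓ                                               ∎
  where
  open ≤-Reasoning
  fibre : Fin m → Fin k → Bool
  fibre i a = ⌊ f i ≟ᶠ a ⌋
  hasColour : ∀ i → 1 ≤ count (allFin k) (fibre i)
  hasColour i = ∈⇒1≤count (fibre i) (∈-allFin (f i)) (⇒⌊⌋≡true (f i ≟ᶠ f i) refl)

opposite-inject₁ : {n : ℕ} (i : Fin n) → opposite (inject₁ i) ≡ suc (opposite i)
opposite-inject₁ {suc n} zero    = refl
opposite-inject₁ {suc n} (suc i) = cong inject₁ (opposite-inject₁ i)

opposite-fromℕ : (n : ℕ) → opposite (fromℕ n) ≡ zero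
opposite-fromℕ zero    = refl
opposite-fromℕ (suc n) = cong inject₁ (opposite-fromℕ n)

module _ {V : Set} {D : Digraph V} (C : DirectedCycle D) where
  open DirectedCycle C

  cycle-hasInArc : ∀ s → ∃ λ u → D u (vtx s) ≡ true
  cycle-hasInArc zero    = vtx (fromℕ len) , close
  cycle-hasInArc (suc s) = vtx (inject₁ s) , arcs s

  reverseCycle : DirectedCycle (flip D)
  reverseCycle = record
    { len   = len
    ; vtx   = vtx ∘ opposite
    ; inj   = λ {s} {t} e → trans (sym (opposite-involutive s))
                              (trans (cong opposite (inj e)) (opposite-involutive t))
    ; arcs  = λ i → subst (λ s → D (vtx (inject₁ (opposite i))) (vtx s) ≡ true)
                          (sym (opposite-inject₁ i)) (arcs (opposite i))
    ; close = subst (λ s → D (vtx (fromℕ len)) (vtx s) ≡ true) (sym (opposite-fromℕ len)) close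
    }

  liftCycle : {W : Set} {E : Digraph W} (π : W → V) (y : Fin (suc len) → W) →
    (∀ s → π (y s) ≡ vtx s) → (∀ s t → D (vtx s) (vtx t) ≡ true → E (y s) (y t) ≡ true) →
    DirectedCycle E
  liftCycle π y over lift = record
    { len   = len
    ; vtx   = y
    ; inj   = λ {s} {t} e → inj (trans (sym (over s)) (trans (cong π e) (over t)))
    ; arcs  = λ i → lift _ _ (arcs i)
    ; close = lift _ _ close
    }

orientation-loopless : {n : ℕ} (G : Graph n) {D : Digraph (Fin n)} →
  (∀ u v → D u v ≡ true → adj G u v ≡ true) → ∀ u → D u u ≢ true
orientation-loopless G arc⇒edge u d with trans (sym (arc⇒edge u u d)) (irrefl G u)
... | ()

record MonochromaticArc {V : Set} {k : ℕ} (D : Digraph V) (c : V → Fin k) : Set where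
  field
    tail head  : V
    arc        : D tail head ≡ true
    sameColour : c tail ≡ c head

monochromaticArc : {n k : ℕ} {G : Graph n} {D : Digraph (Fin n)} → (χ> k) G →
  (∀ u v → adj G u v ≡ true → D u v ≡ true ⊎ D v u ≡ true) →
  (c : Fin n → Fin k) → MonochromaticArc D c
monochromaticArc {G = G} χ>k edge⇒arc c
  with any? (λ u → any? (λ v → (adj G u v Bool.≟ true) ×-dec (c u ≟ᶠ c v)))
... | no none = contradiction (c , λ u v uv same → none (u , v , uv , same)) χ>k
... | yes (u , v , uv , same) with edge⇒arc u v uv
...   | inj₁ d = record { tail = u ; head = v ; arc = d ; sameColour = same }
...   | inj₂ d = record { tail = v ; head = u ; arc = d ; sameColour = sym same }

module _ {n : ℕ} (D : Digraph (Fin n)) (m : ℕ) where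

  blowup-forward : ∀ {u v} i → D u v ≡ true → backwardBlowup D m (u , i) (v , i) ≡ true
  blowup-forward i d with i ≟ᶠ i
  ... | yes _  = d
  ... | no i≢i = contradiction refl i≢i

  blowup-backward : ∀ {u v i j} → i ≢ j → D u v ≡ true → backwardBlowup D m (v , i) (u , j) ≡ true
  blowup-backward {i = i} {j} i≢j d with i ≟ᶠ j
  ... | yes i≡j = contradiction i≡j i≢j
  ... | no _    = d

colourClass-arc : {V : Set} {k : ℕ} {D : Digraph V} (c : V → Fin k) {a : Fin k} {u v : V} →
  D u v ≡ true → c u ≡ a → c v ≡ a → induced D (colourIs c a) u v ≡ true
colourClass-arc c {a} {u} {v} d cu cv
  rewrite d | ⇒⌊⌋≡true (c u ≟ᶠ a) cu | ⇒⌊⌋≡true (c v ≟ᶠ a) cv = refl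

module DicolouredBlowup {n m k : ℕ} (D : Digraph (Fin n)) (loopless : ∀ u → D u u ≢ true)
  (c : Fin n × Fin m → Fin k)
  (classAcyclic : ∀ a → Acyclic (induced (backwardBlowup D m) (colourIs c a)))
  (mono : ∀ i → MonochromaticArc D (λ u → c (u , i))) where

  colourClass : Fin k → Digraph (Fin n × Fin m)
  colourClass a = induced (backwardBlowup D m) (colourIs c a)

  classArc : ∀ {a x y} → backwardBlowup D m x y ≡ true → c x ≡ a → c y ≡ a → colourClass a x y ≡ true
  classArc = colourClass-arc {D = backwardBlowup D m} c

  tl hd : Fin m → Fin n
  tl i = MonochromaticArc.tail (mono i)
  hd i = MonochromaticArc.head (mono i)

  arc : ∀ i → D (tl i) (hd i) ≡ true
  arc i = MonochromaticArc.arc (mono i)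

  col : Fin m → Fin k
  col i = c (tl i , i)

  col-head : ∀ i → c (hd i , i) ≡ col i
  col-head i = sym (MonochromaticArc.sameColour (mono i))

  tl≢hd : ∀ i → tl i ≢ hd i
  tl≢hd i e = loopless (tl i) (subst (λ v → D (tl i) v ≡ true) (sym e) (arc i))

  -- (tl i , i) → (hd i , i) ⇢ (tl j , j) → (hd j , j) ⇢ (tl i , i), the dashed arcs backward.
  crossingFourCycle : ∀ {i j} → i ≢ j → col i ≡ col j → D (tl j) (hd i) ≡ true →
    D (tl i) (hd j) ≡ true → DirectedCycle (colourClass (col i))
  crossingFourCycle {i} {j} i≢j same ji ij = record
    { len   = 3
    ; vtx   = w
    ; inj   = w-injective
    ; arcs  = λ { 0F → classArc (blowup-forward D m i (arc i)) refl (col-head i)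
                ; 1F → classArc (blowup-backward D m i≢j ji) (col-head i) colour-j
                ; 2F → classArc (blowup-forward D m j (arc j)) colour-j colour-hd-j }
    ; close = classArc (blowup-backward D m (i≢j ∘ sym) ij) colour-hd-j refl
    }
    where
    w : Fin 4 → Fin n × Fin m
    w 0F = tl i , i
    w 1F = hd i , i
    w 2F = tl j , j
    w 3F = hd j , j
    apart : ∀ {u v} → (u , i) ≢ (v , j)
    apart e = i≢j (cong proj₂ e)
    w-injective : Injective _≡_ _≡_ w
    w-injective {0F} {0F} _ = refl
    w-injective {0F} {1F} e = contradiction (cong proj₁ e) (tl≢hd i)
    w-injective {0F} {2F} e = contradiction e apart
    w-injective {0F} {3F} e = contradiction e apart
    w-injective {1F} {0F} e = contradiction (sym (cong proj₁ e)) (tl≢hd i)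
    w-injective {1F} {1F} _ = refl
    w-injective {1F} {2F} e = contradiction e apart
    w-injective {1F} {3F} e = contradiction e apart
    w-injective {2F} {0F} e = contradiction (sym e) apart
    w-injective {2F} {1F} e = contradiction (sym e) apart
    w-injective {2F} {2F} _ = refl
    w-injective {2F} {3F} e = contradiction (cong proj₁ e) (tl≢hd j)
    w-injective {3F} {0F} e = contradiction (sym e) apart
    w-injective {3F} {1F} e = contradiction (sym e) apart
    w-injective {3F} {2F} e = contradiction (sym (cong proj₁ e)) (tl≢hd j)
    w-injective {3F} {3F} _ = refl
    colour-j : c (tl j , j) ≡ col i
    colour-j = sym same
    colour-hd-j : c (hd j , j) ≡ col i
    colour-hd-j = trans (col-head j) (sym same)

  crossingArcs⇒≡ : ∀ {i j} → col i ≡ col j → D (tl j) (hd i) ≡ true → D (tl i) (hd j) ≡ true → i ≡ j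
  crossingArcs⇒≡ {i} {j} same ji ij with i ≟ᶠ j
  ... | yes i≡j = i≡j
  ... | no  i≢j = contradiction (crossingFourCycle i≢j same ji ij) (classAcyclic (col i))

  tl-injective : ∀ {i j} → col i ≡ col j → tl i ≡ tl j → i ≡ j
  tl-injective {i} {j} same e = crossingArcs⇒≡ same
    (subst (λ u → D u (hd i) ≡ true) e (arc i)) (subst (λ u → D u (hd j) ≡ true) (sym e) (arc j))

  hd-injective : ∀ {i j} → col i ≡ col j → hd i ≡ hd j → i ≡ j
  hd-injective {i} {j} same e = crossingArcs⇒≡ same
    (subst (λ v → D (tl j) v ≡ true) (sym e) (arc j)) (subst (λ v → D (tl i) v ≡ true) e (arc i))

  selected : Fin k → Fin m → Bool
  selected a i = ⌊ col i ≟ᶠ a ⌋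

  F : Fin k → Digraph (Fin n)
  F a u v = ⌊ any? (λ i → (col i ≟ᶠ a) ×-dec (tl i ≟ᶠ u) ×-dec (hd i ≟ᶠ v)) ⌋

  F-arc : ∀ {a} i → col i ≡ a → F a (tl i) (hd i) ≡ true
  F-arc i col≡a = ⇒⌊⌋≡true (any? _) (i , col≡a , refl , refl)

  F-source : ∀ {a u v} → F a u v ≡ true → ∃ λ i → col i ≡ a × tl i ≡ u × hd i ≡ v
  F-source = ⌊⌋≡true⇒ (any? _)

  F⊆D : ∀ {a} u v → F a u v ≡ true → D u v ≡ true
  F⊆D u v uv with F-source uv
  ... | i , _ , refl , refl = arc i

  reversedArc : ∀ {a u v p q} → F a u v ≡ true → col p ≡ a → hd p ≡ u → col q ≡ a → hd q ≡ v →
                colourClass a (v , q) (u , p) ≡ true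
  reversedArc {u = u} {v} {p} {q} uv col-p refl col-q refl =
    classArc (blowup-backward D m q≢p (F⊆D u v uv))
      (trans (col-head q) col-q) (trans (col-head p) col-p)
    where
    q≢p : q ≢ p
    q≢p refl = loopless u (F⊆D u v uv)

  F-acyclic : ∀ a → Acyclic (F a)
  F-acyclic a C = classAcyclic a (reverseCycle (liftCycle C proj₁ y (λ _ → refl) lift))
    where
    open DirectedCycle C
    inCopy : ∀ s → ∃ λ p → col p ≡ a × tl p ≡ proj₁ (cycle-hasInArc C s) × hd p ≡ vtx s
    inCopy s = F-source (proj₂ (cycle-hasInArc C s))
    y : Fin (suc len) → Fin n × Fin m
    y s = vtx s , proj₁ (inCopy s)
    lift : ∀ s t → F a (vtx s) (vtx t) ≡ true → flip (colourClass a) (y s) (y t) ≡ true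
    lift s t st with inCopy s | inCopy t
    ... | p , col-p , _ , hd-p | q , col-q , _ , hd-q = reversedArc st col-p hd-p col-q hd-q

  F-pathForest : ∀ a → PathForest D (F a)
  F-pathForest a = record
    { sub    = F⊆D
    ; outDeg = λ u v w uv uw → sameTail (F-source uv) (F-source uw)
    ; inDeg  = λ u v w vu wu → sameHead (F-source vu) (F-source wu)
    ; acyc   = F-acyclic a
    }
    where
    sameTail : ∀ {u v w} → (∃ λ i → col i ≡ a × tl i ≡ u × hd i ≡ v) →
               (∃ λ j → col j ≡ a × tl j ≡ u × hd j ≡ w) → v ≡ w
    sameTail (i , refl , refl , refl) (j , col-j , tl-j , refl)
      with refl ← tl-injective (sym col-j) (sym tl-j) = refl
    sameHead : ∀ {u v w} → (∃ λ i → col i ≡ a × tl i ≡ v × hd i ≡ u) →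
               (∃ λ j → col j ≡ a × tl j ≡ w × hd j ≡ u) → v ≡ w
    sameHead (i , refl , refl , refl) (j , col-j , refl , hd-j)
      with refl ← hd-injective (sym col-j) (sym hd-j) = refl

  -- Every copy of colour a is charged to the out-degree in F a of its tail.
  selected≤arcCount : ∀ a → count (allFin m) (selected a) ≤ arcCount (F a)
  selected≤arcCount a = count-≤-sumOver-injection (selected a) tl (λ u → count (allFin n) (F a u))
    (allFin m) (AllPairs.map distinctTails (allFin⁺ m)) (tabulate⁺ tailHasOutArc)
    where
    distinctTails : ∀ {i j} → i ≢ j → selected a i ≡ true → selected a j ≡ true → tl i ≢ tl j
    distinctTails i≢j si sj e =
      i≢j (tl-injective (trans (⌊⌋≡true⇒ (_ ≟ᶠ a) si) (sym (⌊⌋≡true⇒ (_ ≟ᶠ a) sj))) e)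
    tailHasOutArc : ∀ i → selected a i ≡ true → 1 ≤ count (allFin n) (F a (tl i))
    tailHasOutArc i si = ∈⇒1≤count (F a (tl i)) (∈-allFin (hd i)) (F-arc i (⌊⌋≡true⇒ (_ ≟ᶠ a) si))

  m≤k*ℓ : (ℓ : ℕ) → (∀ F → PathForest D F → arcCount F ≤ ℓ) → m ≤ k * ℓ
  m≤k*ℓ ℓ maximal = boundedFibres⇒≤ ℓ col
    (λ a → ≤-trans (selected≤arcCount a) (maximal (F a) (F-pathForest a)))

mainTheorem11 : (k : ℕ) → 1 ≤ k → (n : ℕ) → (G : Graph n) → (χ> k) G →
    (D : Digraph (Fin n)) → IsOrientation G D →
    (ℓ : ℕ) → IsLongestPathForestSize D ℓ →
    ¬ Dicolourable k (backwardBlowup D (k * ℓ + 1))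
mainTheorem11 k _ n G χ>k D (arc⇒edge , edge⇒arc , _) ℓ (_ , maximal) (c , classAcyclic) =
  m+1+n≰m (k * ℓ) (DicolouredBlowup.m≤k*ℓ D (orientation-loopless G arc⇒edge) c classAcyclic
    (λ i → monochromaticArc {G = G} χ>k edge⇒arc (λ u → c (u , i))) ℓ maximal)
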